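{- Let $G \in \mathcal{C}$, let $S$ be a minimal separator of $G$ with distinct full components $L,R$, let $Z,Z',f,g,W,Z_L,Z_R$ be as in the context (with $|Z|,|Z'|\ge 2$), let $F$ be a $k$-colorable induced subgraph of $G$ with a fixed partition $V(F)=I_1\cup\dots\cup I_k$ into independent sets, and let $i^j_L, i^j_R$ ($1\le j\le k$) and $\widehat{S}$ be as defined in the context. Then $\widehat{S}$ is an $F$-container for $S$, i.e., $S \subseteq \widehat{S}$ and $\widehat{S}\cap V(F) = S \cap V(F)$.
   Context: $\mathcal{C}$ is the class of graphs with no induced cycle of length at least $6$ and no induced extended $C_5$ (a five-vertex induced cycle plus a vertex adjacent to exactly one or exactly two consecutive of its vertices). $N(X)$ is the open neighborhood. A minimal separator $S$ is a set such that $G-S$ has at least two components $D$ with $N(D)=S$ (full components). Setting: $Z \subseteq L$ is a clique with $S \subseteq N(Z)$ and $(N(z)\cap S)\setminus N(Z\setminus\{z\}) \ne \emptyset$ for all $z \in Z$; $Z' \subseteq R$ is a clique with the analogous properties. For $z \in Z$, $f(z) \in (N(z)\cap S)\setminus N(Z\setminus\{z\})$ and $g(z)$ is a neighbor of $f(z)$ in $R$; for $z\in Z'$, $f(z) \in (N(z)\cap S)\setminus N(Z'\setminus\{z\})$ and $g(z)$ is a neighbor of $f(z)$ in $L$. Choose distinct $a_1,a_2\in Z$, $b_i=f(a_i)$, $r_i=g(a_i)$; distinct $d_1,d_2\in Z'$, $c_i=f(d_i)$, $l_i=g(d_i)$. $W=\{a_1,a_2,b_1,b_2,r_1,r_2,c_1,c_2,d_1,d_2,l_1,l_2\}$.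 A profile is $T\subseteq W$ meeting each of $\{a_1,b_1,r_1\},\{a_2,b_2,r_2\},\{c_1,d_1,l_1\},\{c_2,d_2,l_2\}$; it is $L$-ambiguous if $T\subseteq\{a_1,a_2,b_1,b_2,c_1,c_2,l_1,l_2\}$, $R$-ambiguous if $T\subseteq\{b_1,b_2,c_1,c_2,d_1,d_2,r_1,r_2\}$, strictly $L$-ambiguous if $L$- but not $R$-ambiguous, strictly $R$-ambiguous if $R$- but not $L$-ambiguous, and unambiguous if neither. $Z_R$ = vertices complete to $\{d_1,d_2\}$ and anticomplete to $\{c_1,c_2,l_1,l_2\}$; $Z_L$ = vertices complete to $\{a_1,a_2\}$ and anticomplete to $\{b_1,b_2,r_1,r_2\}$. For $1\le j\le k$: $i^j_L$ is a vertex of $I_j\setminus(S\cup R)$ with $N(i^j_L)\cap W$ an $L$-ambiguous profile and $N(i^j_L)\cap Z_R$ inclusion-wise maximal among all such vertices; $i^j_R$ is a vertex of $I_j\setminus(S\cup L)$ with $N(i^j_R)\cap W$ an $R$-ambiguous profile and $N(i^j_R)\cap Z_L$ inclusion-wise maximal among all such vertices; if no such vertex exists the corresponding symbol is $\bot$, with $N(\bot)=\emptyset$. $\widehat{S}$ consists of: $b_1,b_2,c_1,c_2$; all $v$ with $N(v)\cap W$ an unambiguous profile; all $v$ with $N(v)\cap W$ strictly $L$-ambiguous profile having a neighbor in $Z_R\setminus\bigcup_j N(i^j_L)$; all $v$ with $N(v)\cap W$ strictly $R$-ambiguous profile having a neighbor in $Z_L\setminus\bigcup_j N(i^j_R)$;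 all $v$ with $N(v)\cap W$ a profile that is both $L$- and $R$-ambiguous having a neighbor in $Z_R\setminus\bigcup_jN(i^j_L)$ and a neighbor in $Z_L\setminus\bigcup_jN(i^j_R)$. For an induced subgraph $F$, $A$ is an $F$-container for $\Omega$ if $\Omega\subseteq A$ and $A\cap V(F)=\Omega\cap V(F)$. -}

module Defs where

open import Data.Nat using (ℕ; suc; _+_; _%_)
open import Data.Fin using (Fin; toℕ)
open import Data.Fin.Subset using (Subset; _∈_; _∉_; _⊆_; Nonempty)
open import Data.Maybe using (Maybe; just; nothing)
open import Data.Product using (Σ; ∃; _×_; _,_)
open import Data.Sum using (_⊎_)
open import Data.Empty using (⊥)
open import Relation.Nullary using (¬_)
open import Relation.Binary using (Decidable)
open import Relation.Binary.PropositionalEquality using (_≡_; _≢_)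
open import Function.Definitions using (Injective)

infix 2 _iff_
_iff_ : Set → Set → Set
A iff B = (A → B) × (B → A)

record Graph (n : ℕ) : Set₁ where
  field
    Adj    : Fin n → Fin n → Set
    adj?   : Decidable Adj
    sym    : ∀ {u v} → Adj u v → Adj v u
    irrefl : ∀ {u} → ¬ Adj u u

CycAdj : (m : ℕ) → Fin (suc m) → Fin (suc m) → Set
CycAdj m i j = ((toℕ i + 1) % suc m ≡ toℕ j) ⊎ ((toℕ j + 1) % suc m ≡ toℕ i)

module _ {n : ℕ} (G : Graph n) where
  open Graph G

  InducedCycle : (m : ℕ) → (Fin (suc m) → Fin n) → Set
  InducedCycle m c = Injective _≡_ _≡_ c × (∀ i j → Adj (c i) (c j) iff CycAdj m i j)

  ExtendedC5 : (Fin 5 → Fin n) → Fin n → Set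
  ExtendedC5 c x = InducedCycle 4 c × (∀ i → x ≢ c i)
    × ((∃ λ i → ∀ j → Adj x (c j) iff (j ≡ i))
      ⊎ (∃ λ i → ∀ j → Adj x (c j) iff (j ≡ i ⊎ (toℕ i + 1) % 5 ≡ toℕ j)))

  InClassC : Set
  InClassC = (∀ p (c : Fin (6 + p) → Fin n) → ¬ InducedCycle (5 + p) c)
           × (∀ c x → ¬ ExtendedC5 c x)

  Nb : (Fin n → Set) → Fin n → Set
  Nb X v = ¬ X v × ∃ λ u → X u × Adj u v

  data Walk (D : Subset n) : Fin n → Fin n → Set where
    here : ∀ {u} → u ∈ D → Walk D u u
    step : ∀ {u v w} → u ∈ D → Adj u v → Walk D v w → Walk D u w

  Connected : Subset n → Set
  Connected D = ∀ u v → u ∈ D → v ∈ D → Walk D u v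

  Component : Subset n → Subset n → Set
  Component S D = Nonempty D × (∀ v → v ∈ D → v ∉ S) × Connected D
    × (∀ u v → u ∈ D → Adj u v → v ∉ S → v ∈ D)

  FullComponent : Subset n → Subset n → Set
  FullComponent S D = Component S D × (∀ v → (v ∈ S) iff Nb (_∈ D) v)

  Clique : Subset n → Set
  Clique Z = ∀ u v → u ∈ Z → v ∈ Z → u ≢ v → Adj u v

  Private : Subset n → Subset n → Fin n → Fin n → Set
  Private S Z z s = s ∈ S × Adj z s × ¬ Nb (λ u → u ∈ Z × u ≢ z) s

record Setting {n : ℕ} (G : Graph n) : Set where
  open Graph G
  field
    S L R      : Subset n
    L-full     : FullComponent G S L
    R-full     : FullComponent G S R
    L≢R        : L ≢ R
    Z Z′       : Subset n
    Z⊆L        : Z ⊆ L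
    Z′⊆R       : Z′ ⊆ R
    Z-clique   : Clique G Z
    Z′-clique  : Clique G Z′
    S⊆NZ       : ∀ v → v ∈ S → Nb G (_∈ Z) v
    S⊆NZ′      : ∀ v → v ∈ S → Nb G (_∈ Z′) v
    Z-priv     : ∀ z → z ∈ Z → ∃ λ s → Private G S Z z s
    Z′-priv    : ∀ z → z ∈ Z′ → ∃ λ s → Private G S Z′ z s
    f g        : Fin n → Fin n
    f-Z        : ∀ z → z ∈ Z → Private G S Z z (f z)
    g-Z        : ∀ z → z ∈ Z → g z ∈ R × Adj (f z) (g z)
    f-Z′       : ∀ z → z ∈ Z′ → Private G S Z′ z (f z)
    g-Z′       : ∀ z → z ∈ Z′ → g z ∈ L × Adj (f z) (g z)
    a₁ a₂ d₁ d₂ : Fin n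
    a₁∈Z       : a₁ ∈ Z
    a₂∈Z       : a₂ ∈ Z
    a₁≢a₂      : a₁ ≢ a₂
    d₁∈Z′      : d₁ ∈ Z′
    d₂∈Z′      : d₂ ∈ Z′
    d₁≢d₂      : d₁ ≢ d₂

-- F: induced subgraph with vertex set I₁ ∪ … ∪ I_k, I_j pairwise disjoint independent sets
record Colouring {n : ℕ} (G : Graph n) (k : ℕ) : Set where
  open Graph G
  field
    I        : Fin k → Subset n
    indep    : ∀ j u v → u ∈ I j → v ∈ I j → ¬ Adj u v
    disjoint : ∀ j j′ v → v ∈ I j → v ∈ I j′ → j ≡ j′

  VF : Fin _ → Set
  VF v = ∃ λ j → v ∈ I j

module Construction {n : ℕ} {G : Graph n} (σ : Setting G) where
  open Graph G
  open Setting σ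

  b₁ b₂ r₁ r₂ c₁ c₂ l₁ l₂ : Fin n
  b₁ = f a₁
  b₂ = f a₂
  r₁ = g a₁
  r₂ = g a₂
  c₁ = f d₁
  c₂ = f d₂
  l₁ = g d₁
  l₂ = g d₂

  InW : Fin n → Set
  InW w = w ≡ a₁ ⊎ w ≡ a₂ ⊎ w ≡ b₁ ⊎ w ≡ b₂ ⊎ w ≡ r₁ ⊎ w ≡ r₂
        ⊎ w ≡ c₁ ⊎ w ≡ c₂ ⊎ w ≡ d₁ ⊎ w ≡ d₂ ⊎ w ≡ l₁ ⊎ w ≡ l₂

  -- N(v) ∩ W is a profile (it is automatically a subset of W)
  Profile : Fin n → Set
  Profile v = (Adj v a₁ ⊎ Adj v b₁ ⊎ Adj v r₁) × (Adj v a₂ ⊎ Adj v b₂ ⊎ Adj v r₂)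
            × (Adj v c₁ ⊎ Adj v d₁ ⊎ Adj v l₁) × (Adj v c₂ ⊎ Adj v d₂ ⊎ Adj v l₂)

  LAmb : Fin n → Set
  LAmb v = ∀ w → InW w → Adj v w →
    w ≡ a₁ ⊎ w ≡ a₂ ⊎ w ≡ b₁ ⊎ w ≡ b₂ ⊎ w ≡ c₁ ⊎ w ≡ c₂ ⊎ w ≡ l₁ ⊎ w ≡ l₂

  RAmb : Fin n → Set
  RAmb v = ∀ w → InW w → Adj v w →
    w ≡ b₁ ⊎ w ≡ b₂ ⊎ w ≡ c₁ ⊎ w ≡ c₂ ⊎ w ≡ d₁ ⊎ w ≡ d₂ ⊎ w ≡ r₁ ⊎ w ≡ r₂

  ZR : Fin n → Set
  ZR z = Adj z d₁ × Adj z d₂ × ¬ Adj z c₁ × ¬ Adj z c₂ × ¬ Adj z l₁ × ¬ Adj z l₂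

  ZL : Fin n → Set
  ZL z = Adj z a₁ × Adj z a₂ × ¬ Adj z b₁ × ¬ Adj z b₂ × ¬ Adj z r₁ × ¬ Adj z r₂

  -- adjacency to a possibly-⊥ vertex (N(⊥) = ∅)
  AdjM : Maybe (Fin n) → Fin n → Set
  AdjM nothing  z = ⊥
  AdjM (just x) z = Adj x z

  module _ {k : ℕ} (F : Colouring G k) where
    open Colouring F

    CandL : Fin k → Fin n → Set
    CandL j x = x ∈ I j × x ∉ S × x ∉ R × Profile x × LAmb x

    CandR : Fin k → Fin n → Set
    CandR j x = x ∈ I j × x ∉ S × x ∉ L × Profile x × RAmb x

    -- i^j_L: a candidate with N(·) ∩ Z_R inclusion-wise maximal, or ⊥ if none
    IsIL : Fin k → Maybe (Fin n) → Set
    IsIL j nothing  = ∀ y → ¬ CandL j y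
    IsIL j (just x) = CandL j x × (∀ y → CandL j y →
      (∀ z → ZR z → Adj x z → Adj y z) → (∀ z → ZR z → Adj y z → Adj x z))

    -- i^j_R: a candidate with N(·) ∩ Z_L inclusion-wise maximal, or ⊥ if none
    IsIR : Fin k → Maybe (Fin n) → Set
    IsIR j nothing  = ∀ y → ¬ CandR j y
    IsIR j (just x) = CandR j x × (∀ y → CandR j y →
      (∀ z → ZL z → Adj x z → Adj y z) → (∀ z → ZL z → Adj y z → Adj x z))

    module _ (iL iR : Fin k → Maybe (Fin n)) where

      HitZR : Fin n → Set
      HitZR v = ∃ λ z → ZR z × Adj v z × (∀ j → ¬ AdjM (iL j) z)

      HitZL : Fin n → Set
      HitZL v = ∃ λ z → ZL z × Adj v z × (∀ j → ¬ AdjM (iR j) z)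

      Ŝ : Fin n → Set
      Ŝ v = (v ≡ b₁ ⊎ v ≡ b₂ ⊎ v ≡ c₁ ⊎ v ≡ c₂)
          ⊎ (Profile v × ¬ LAmb v × ¬ RAmb v)
          ⊎ (Profile v × LAmb v × ¬ RAmb v × HitZR v)
          ⊎ (Profile v × RAmb v × ¬ LAmb v × HitZL v)
          ⊎ (Profile v × LAmb v × RAmb v × HitZR v × HitZL v)

      IsFContainer : Set
      IsFContainer = (∀ v → v ∈ S → Ŝ v) × (∀ v → VF v → Ŝ v iff v ∈ S)

-- Every vertex v of S meets each triple a, f a, g a (a ∈ Z or Z′): otherwise a
-- neighbour of v in Z, the path v–z–a–f a–g a and neighbours of v and f a in Z′
-- close a hole of length 6 or an extended C₅.  So N(v) ∩ W is a profile, and when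
-- it is L-ambiguous a Z′-neighbour of v lies in Z_R and in R, out of reach of every
-- i^j_L; symmetrically for R.  Conversely a vertex of F outside S lies in L or R, so
-- if it were in Ŝ it would be a candidate for some i^j_L (or i^j_R) with a
-- neighbour in Z_R that i^j_L misses.  But the candidates of one colour class have
-- nested neighbourhoods in Z_R: a crossing pair v, x together with d₂ and the edge
-- c₁l₁ again yields a long hole or an extended C₅.  Hence the maximal candidate
-- i^j_L sees every vertex of Z_R that any candidate of its class sees.

module Submission where

open import Defs
open import Data.Nat using (ℕ; suc; _+_; _%_)
open import Data.Nat.Properties using (<⇒≤) renaming (_≟_ to _≟ℕ_)
open import Data.Fin using (Fin; zero; suc; toℕ; _≤_; _<_; _≟_; _≤?_; _<?_)
open import Data.Fin.Properties using (all?; any?; <-cmp; ≤-refl)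
open import Data.Fin.Subset using (_∈_; _∉_; _⊆_)
open import Data.Fin.Subset.Properties using (_∈?_; ⊆-antisym)
open import Data.List using (List; filter; cartesianProduct; allFin)
open import Data.List.Relation.Unary.All as All using (All; []; _∷_)
open import Data.List.Membership.Propositional.Properties using (∈-filter⁺; ∈-cartesianProduct⁺; ∈-allFin)
open import Data.Vec using (Vec; []; _∷_; lookup)
open import Data.Maybe using (Maybe; just; nothing)
open import Data.Product using (∃; _×_; _,_; proj₁; proj₂; uncurry)
open import Function using (_∘_)
open import Data.Sum using (_⊎_; inj₁; inj₂) renaming (swap to ⊎-swap)
open import Data.Empty using (⊥; ⊥-elim)
open import Relation.Binary using (Decidable; tri<; tri≈; tri>)
open import Relation.Binary.PropositionalEquality using (_≡_; _≢_; refl; subst; ≢-sym) renaming (sym to ≡-sym)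
open import Relation.Nullary using (¬_; Dec; yes; no; ¬?; _×-dec_; _⊎-dec_; _→-dec_; from-yes)

module _ {A B : Set} (N : A → B → Set) (U : B → Set) (Cand : A → Set) where

  Laminar : Set
  Laminar = ∀ {u v z w} → Cand u → Cand v → U z → U w → N u z → ¬ N v z → N v w → ¬ N u w → ⊥

  Maximal : A → Set
  Maximal x = ∀ y → Cand y → (∀ z → U z → N x z → N y z) → ∀ z → U z → N y z → N x z

  laminar-maximal⇒greatest : (∀ a b → Dec (N a b)) → Laminar
    → ∀ {x y z} → Cand x → Maximal x → Cand y → U z → N y z → N x z
  laminar-maximal⇒greatest N? laminar {x} {y} {z} cx max cy uz yz with N? x z
  ... | yes xz = xz
  ... | no ¬xz = max y cy x⊆y z uz yz
    where
    x⊆y : ∀ w → U w → N x w → N y w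
    x⊆y w uw xw with N? y w
    ... | yes yw = yw
    ... | no ¬yw = ⊥-elim (laminar cy cx uz uw yz ¬xz xw ¬yw)

cycAdj? : ∀ m → Decidable (CycAdj m)
cycAdj? m i j = ((toℕ i + 1) % suc m ≟ℕ toℕ j) ⊎-dec ((toℕ j + 1) % suc m ≟ℕ toℕ i)

-- Edges are filtered from the pairs i ≤ j rather than i < j: on the concrete cycles
-- used below the diagonal contributes nothing, and no irreflexivity proof is needed.
IsCycleEdge IsCycleChord : ∀ m → Fin (suc m) × Fin (suc m) → Set
IsCycleEdge m (i , j) = i ≤ j × CycAdj m i j
IsCycleChord m (i , j) = i < j × ¬ CycAdj m i j

isCycleEdge? : ∀ m p → Dec (IsCycleEdge m p)
isCycleEdge? m (i , j) = i ≤? j ×-dec cycAdj? m i j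

isCycleChord? : ∀ m p → Dec (IsCycleChord m p)
isCycleChord? m (i , j) = i <? j ×-dec ¬? (cycAdj? m i j)

cycleEdges cycleChords : ∀ m → List (Fin (suc m) × Fin (suc m))
cycleEdges m = filter (isCycleEdge? m) (cartesianProduct (allFin _) (allFin _))
cycleChords m = filter (isCycleChord? m) (cartesianProduct (allFin _) (allFin _))

module _ {m : ℕ} {P : Fin (suc m) × Fin (suc m) → Set} where

  All-cycleEdges : All P (cycleEdges m) → ∀ {i j} → IsCycleEdge m (i , j) → P (i , j)
  All-cycleEdges all {i} {j} ij = All.lookup all
    (∈-filter⁺ (isCycleEdge? m) (∈-cartesianProduct⁺ (∈-allFin i) (∈-allFin j)) ij)

  All-cycleChords : All P (cycleChords m) → ∀ {i j} → IsCycleChord m (i , j) → P (i , j)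
  All-cycleChords all {i} {j} ij = All.lookup all
    (∈-filter⁺ (isCycleChord? m) (∈-cartesianProduct⁺ (∈-allFin i) (∈-allFin j)) ij)

DistinctNeighbourhoods : ℕ → Set
DistinctNeighbourhoods m = ∀ i j → i ≢ j → ∃ λ k → CycAdj m k i × ¬ CycAdj m k j

distinctNeighbourhoods? : ∀ m → Dec (DistinctNeighbourhoods m)
distinctNeighbourhoods? m = all? λ i → all? λ j →
  ¬? (i ≟ j) →-dec any? λ k → cycAdj? m k i ×-dec ¬? (cycAdj? m k j)

distinctNeighbourhoods-C₅ : DistinctNeighbourhoods 4
distinctNeighbourhoods-C₅ = from-yes (distinctNeighbourhoods? 4)

distinctNeighbourhoods-C₆ : DistinctNeighbourhoods 5
distinctNeighbourhoods-C₆ = from-yes (distinctNeighbourhoods? 5)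

distinctNeighbourhoods-C₇ : DistinctNeighbourhoods 6
distinctNeighbourhoods-C₇ = from-yes (distinctNeighbourhoods? 6)

module _ {n : ℕ} {G : Graph n} where
  open Graph G

  infix 4 _∼_ _≁_
  _∼_ _≁_ : Fin n → Fin n → Set
  u ∼ v = Adj u v
  u ≁ v = ¬ Adj u v

  sym≁ : ∀ {u v} → u ≁ v → v ≁ u
  sym≁ u≁v v∼u = u≁v (sym v∼u)

  ∼⇒≢ : ∀ {u v} → u ∼ v → u ≢ v
  ∼⇒≢ u∼u refl = irrefl u∼u

  ∼≁⇒≢ : ∀ {u v w} → u ∼ w → v ≁ w → u ≢ v
  ∼≁⇒≢ u∼w u≁w refl = u≁w u∼w

  ≁∼⇒≢ : ∀ {u v w} → u ≁ w → v ∼ w → u ≢ v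
  ≁∼⇒≢ u≁w v∼w = ≢-sym (∼≁⇒≢ v∼w u≁w)

  walk-head : ∀ {D u w} → Walk G D u w → u ∈ D
  walk-head (here u∈D) = u∈D
  walk-head (step u∈D _ _) = u∈D

  walk-stays : ∀ {S C D u w} → Component G S C → (∀ v → v ∈ D → v ∉ S)
    → Walk G D u w → u ∈ C → w ∈ C
  walk-stays _ _ (here _) u∈C = u∈C
  walk-stays C@(_ , _ , _ , closed) D∌S (step _ u∼v walk) u∈C =
    walk-stays C D∌S walk (closed _ _ u∈C u∼v (D∌S _ (walk-head walk)))

  components-overlap⇒⊆ : ∀ {S C D v} → Component G S C → Component G S D
    → v ∈ C → v ∈ D → C ⊆ D
  components-overlap⇒⊆ {v = v} (_ , C∌S , connected , _) D v∈C v∈D {w} w∈C =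
    walk-stays D C∌S (connected v w v∈C w∈C) v∈D

  CycleEdges Chordless : ∀ {m} → Vec (Fin n) (suc m) → Set
  CycleEdges {m} xs = All (uncurry λ i j → lookup xs i ∼ lookup xs j) (cycleEdges m)
  Chordless {m} xs = All (uncurry λ i j → lookup xs i ≁ lookup xs j) (cycleChords m)

  -- Injectivity comes for free: distinct vertices of the cycle have distinct
  -- neighbourhoods, which the adjacency pattern transfers to their images.
  inducedCycle : ∀ {m} → DistinctNeighbourhoods m → (xs : Vec (Fin n) (suc m))
    → CycleEdges xs → Chordless xs → InducedCycle G m (lookup xs)
  inducedCycle {m} distinct xs edges chords = injective , λ i j → adj⇒cyc i j , cyc⇒adj i j
    where
    c = lookup xs

    adj⇒cyc< : ∀ {i j} → i < j → c i ∼ c j → CycAdj m i j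
    adj⇒cyc< {i} {j} i<j ci∼cj with cycAdj? m i j
    ... | yes ij = ij
    ... | no ¬ij = ⊥-elim (All-cycleChords chords (i<j , ¬ij) ci∼cj)

    cyc⇒adj : ∀ i j → CycAdj m i j → c i ∼ c j
    cyc⇒adj i j ij with <-cmp i j
    ... | tri< i<j _ _ = All-cycleEdges edges (<⇒≤ i<j , ij)
    ... | tri≈ _ refl _ = All-cycleEdges edges (≤-refl , ij)
    ... | tri> _ _ j<i = sym (All-cycleEdges edges (<⇒≤ j<i , ⊎-swap ij))

    adj⇒cyc : ∀ i j → c i ∼ c j → CycAdj m i j
    adj⇒cyc i j ci∼cj with <-cmp i j
    ... | tri< i<j _ _ = adj⇒cyc< i<j ci∼cj
    ... | tri≈ _ refl _ = ⊥-elim (irrefl ci∼cj)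
    ... | tri> _ _ j<i = ⊎-swap (adj⇒cyc< j<i (sym ci∼cj))

    injective : ∀ {i j} → c i ≡ c j → i ≡ j
    injective {i} {j} ci≡cj with i ≟ j
    ... | yes i≡j = i≡j
    ... | no i≢j with distinct i j i≢j
    ...   | k , ki , ¬kj = ⊥-elim (¬kj (adj⇒cyc k j (subst (c k ∼_) ci≡cj (cyc⇒adj k i ki))))

  module Forbidden (cC : InClassC G) where

    no-C₆ : (xs : Vec (Fin n) 6) → CycleEdges xs → Chordless xs → ⊥
    no-C₆ xs edges chords =
      proj₁ cC 0 (lookup xs) (inducedCycle distinctNeighbourhoods-C₆ xs edges chords)

    no-C₇ : (xs : Vec (Fin n) 7) → CycleEdges xs → Chordless xs → ⊥
    no-C₇ xs edges chords =
      proj₁ cC 1 (lookup xs) (inducedCycle distinctNeighbourhoods-C₇ xs edges chords)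

    no-C₅-with-pendant : ∀ {x₀ x₁ x₂ x₃ x₄ y}
      → CycleEdges (x₀ ∷ x₁ ∷ x₂ ∷ x₃ ∷ x₄ ∷ []) → Chordless (x₀ ∷ x₁ ∷ x₂ ∷ x₃ ∷ x₄ ∷ [])
      → y ∼ x₀ → y ≁ x₁ → y ≁ x₂ → y ≁ x₃ → y ≁ x₄ → ⊥
    no-C₅-with-pendant {x₀} {x₁} {x₂} {x₃} {x₄} {y}
      edges@(_ ∷ _ ∷ x₁∼x₂ ∷ x₂∼x₃ ∷ x₃∼x₄ ∷ []) chords y∼x₀ y≁x₁ y≁x₂ y≁x₃ y≁x₄ =
      proj₂ cC (lookup xs) y (inducedCycle distinctNeighbourhoods-C₅ xs edges chords ,
        outside , inj₁ (zero , attached))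
      where
      xs = x₀ ∷ x₁ ∷ x₂ ∷ x₃ ∷ x₄ ∷ []

      outside : ∀ i → y ≢ lookup xs i
      outside zero = ∼⇒≢ y∼x₀
      outside (suc zero) = ≁∼⇒≢ y≁x₂ x₁∼x₂
      outside (suc (suc zero)) = ≁∼⇒≢ y≁x₁ (sym x₁∼x₂)
      outside (suc (suc (suc zero))) = ≁∼⇒≢ y≁x₂ (sym x₂∼x₃)
      outside (suc (suc (suc (suc zero)))) = ≁∼⇒≢ y≁x₃ (sym x₃∼x₄)

      attached : ∀ j → y ∼ lookup xs j iff j ≡ zero
      attached zero = (λ _ → refl) , λ _ → y∼x₀
      attached (suc zero) = (λ y∼ → ⊥-elim (y≁x₁ y∼)) , λ ()
      attached (suc (suc zero)) = (λ y∼ → ⊥-elim (y≁x₂ y∼)) , λ ()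
      attached (suc (suc (suc zero))) = (λ y∼ → ⊥-elim (y≁x₃ y∼)) , λ ()
      attached (suc (suc (suc (suc zero)))) = (λ y∼ → ⊥-elim (y≁x₄ y∼)) , λ ()

    no-C₅-with-triangle : ∀ {x₀ x₁ x₂ x₃ x₄ y}
      → CycleEdges (x₀ ∷ x₁ ∷ x₂ ∷ x₃ ∷ x₄ ∷ []) → Chordless (x₀ ∷ x₁ ∷ x₂ ∷ x₃ ∷ x₄ ∷ [])
      → y ∼ x₀ → y ∼ x₁ → y ≁ x₂ → y ≁ x₃ → y ≁ x₄ → ⊥
    no-C₅-with-triangle {x₀} {x₁} {x₂} {x₃} {x₄} {y}
      edges@(_ ∷ _ ∷ _ ∷ x₂∼x₃ ∷ x₃∼x₄ ∷ []) chords y∼x₀ y∼x₁ y≁x₂ y≁x₃ y≁x₄ =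
      proj₂ cC (lookup xs) y (inducedCycle distinctNeighbourhoods-C₅ xs edges chords ,
        outside , inj₂ (zero , attached))
      where
      xs = x₀ ∷ x₁ ∷ x₂ ∷ x₃ ∷ x₄ ∷ []

      outside : ∀ i → y ≢ lookup xs i
      outside zero = ∼⇒≢ y∼x₀
      outside (suc zero) = ∼⇒≢ y∼x₁
      outside (suc (suc zero)) = ≁∼⇒≢ y≁x₃ x₂∼x₃
      outside (suc (suc (suc zero))) = ≁∼⇒≢ y≁x₂ (sym x₂∼x₃)
      outside (suc (suc (suc (suc zero)))) = ≁∼⇒≢ y≁x₃ (sym x₃∼x₄)

      attached : ∀ j → y ∼ lookup xs j iff (j ≡ zero ⊎ (toℕ {5} zero + 1) % 5 ≡ toℕ j)
      attached zero = (λ _ → inj₁ refl) , λ _ → y∼x₀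
      attached (suc zero) = (λ _ → inj₂ refl) , λ _ → y∼x₁
      attached (suc (suc zero)) = (λ y∼ → ⊥-elim (y≁x₂ y∼)) , λ { (inj₁ ()) ; (inj₂ ()) }
      attached (suc (suc (suc zero))) = (λ y∼ → ⊥-elim (y≁x₃ y∼)) , λ { (inj₁ ()) ; (inj₂ ()) }
      attached (suc (suc (suc (suc zero)))) = (λ y∼ → ⊥-elim (y≁x₄ y∼)) , λ { (inj₁ ()) ; (inj₂ ()) }

    -- A vertex p adjacent to both v and b closes v–z–a–b into a C₅ that r extends;
    -- otherwise the edge pq closes it into a C₆.
    no-bridged-P₅ : ∀ {v z a b r p q}
      → v ∼ z → z ∼ a → a ∼ b → b ∼ r
      → v ≁ a → v ≁ b → v ≁ r → z ≁ b → z ≁ r → a ≁ r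
      → p ∼ v → q ∼ b → (p ≢ q → p ∼ q) → p ≁ z → p ≁ a → q ≁ z → q ≁ a → ⊥
    no-bridged-P₅ {v} {z} {a} {b} {r} {p} {q} v∼z z∼a a∼b b∼r v≁a v≁b v≁r z≁b z≁r a≁r
      p∼v q∼b p∼q p≁z p≁a q≁z q≁a = cases (adj? p b) (adj? q v)
      where
      closed-by : ∀ {w} → w ∼ v → w ∼ b → w ≁ z → w ≁ a → ⊥
      closed-by {w} w∼v w∼b w≁z w≁a = extend (adj? r w)
        where
        edges : CycleEdges (b ∷ w ∷ v ∷ z ∷ a ∷ [])
        edges = sym w∼b ∷ sym a∼b ∷ w∼v ∷ v∼z ∷ z∼a ∷ []
        chords : Chordless (b ∷ w ∷ v ∷ z ∷ a ∷ [])
        chords = sym≁ v≁b ∷ sym≁ z≁b ∷ w≁z ∷ w≁a ∷ v≁a ∷ []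
        extend : Dec (r ∼ w) → ⊥
        extend (yes r∼w) = no-C₅-with-triangle edges chords (sym b∼r) r∼w
          (sym≁ v≁r) (sym≁ z≁r) (sym≁ a≁r)
        extend (no r≁w) = no-C₅-with-pendant edges chords (sym b∼r) r≁w
          (sym≁ v≁r) (sym≁ z≁r) (sym≁ a≁r)

      cases : Dec (p ∼ b) → Dec (q ∼ v) → ⊥
      cases (yes p∼b) _ = closed-by p∼v p∼b p≁z p≁a
      cases (no _) (yes q∼v) = closed-by q∼v q∼b q≁z q≁a
      cases (no p≁b) (no q≁v) =
        no-C₆ (v ∷ z ∷ a ∷ b ∷ q ∷ p ∷ [])
          (v∼z ∷ sym p∼v ∷ z∼a ∷ a∼b ∷ sym q∼b ∷ sym (p∼q (∼≁⇒≢ p∼v q≁v)) ∷ [])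
          (v≁a ∷ v≁b ∷ sym≁ q≁v ∷ z≁b ∷ sym≁ q≁z ∷ sym≁ p≁z ∷ sym≁ q≁a ∷ sym≁ p≁a ∷ sym≁ p≁b ∷ [])

    -- An induced path v–z–e–w–x, except that z and w may be adjacent.
    record Crossing (v z e w x : Fin n) : Set where
      field
        v∼z : v ∼ z
        z∼e : z ∼ e
        e∼w : e ∼ w
        w∼x : w ∼ x
        v≁e : v ≁ e
        v≁w : v ≁ w
        v≁x : v ≁ x
        z≁x : z ≁ x
        e≁x : e ≁ x

    crossing-no-common-neighbour : ∀ {v z e w x y} → Crossing v z e w x
      → y ∼ v → y ∼ x → y ≁ z → y ≁ e → y ≁ w → ⊥
    crossing-no-common-neighbour {v} {z} {e} {w} {x} {y} c y∼v y∼x y≁z y≁e y≁w with adj? z w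
    ... | yes z∼w =
      no-C₅-with-triangle {w} {z} {v} {y} {x}
        (sym z∼w ∷ w∼x ∷ sym v∼z ∷ sym y∼v ∷ y∼x ∷ [])
        (sym≁ v≁w ∷ sym≁ y≁w ∷ sym≁ y≁z ∷ z≁x ∷ v≁x ∷ [])
        e∼w (sym z∼e) (sym≁ v≁e) (sym≁ y≁e) e≁x
      where open Crossing c
    ... | no z≁w =
      no-C₆ (v ∷ z ∷ e ∷ w ∷ x ∷ y ∷ [])
        (v∼z ∷ sym y∼v ∷ z∼e ∷ e∼w ∷ w∼x ∷ sym y∼x ∷ [])
        (v≁e ∷ v≁w ∷ v≁x ∷ z≁w ∷ z≁x ∷ sym≁ y≁z ∷ e≁x ∷ sym≁ y≁e ∷ sym≁ y≁w ∷ [])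
      where open Crossing c

    crossing-no-linking-edge : ∀ {v z e w x p q} → Crossing v z e w x
      → p ∼ q → v ∼ p → x ∼ q → v ≁ q → x ≁ p
      → p ≁ z × p ≁ e × p ≁ w → q ≁ z × q ≁ e × q ≁ w → ⊥
    crossing-no-linking-edge {v} {z} {e} {w} {x} {p} {q} c p∼q v∼p x∼q v≁q x≁p
      (p≁z , p≁e , p≁w) (q≁z , q≁e , q≁w) with adj? z w
    ... | yes z∼w =
      no-C₆ (v ∷ z ∷ w ∷ x ∷ q ∷ p ∷ [])
        (v∼z ∷ v∼p ∷ z∼w ∷ w∼x ∷ x∼q ∷ sym p∼q ∷ [])
        (v≁w ∷ v≁x ∷ v≁q ∷ z≁x ∷ sym≁ q≁z ∷ sym≁ p≁z ∷ sym≁ q≁w ∷ sym≁ p≁w ∷ x≁p ∷ [])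
      where open Crossing c
    ... | no z≁w =
      no-C₇ (v ∷ z ∷ e ∷ w ∷ x ∷ q ∷ p ∷ [])
        (v∼z ∷ v∼p ∷ z∼e ∷ e∼w ∷ w∼x ∷ x∼q ∷ sym p∼q ∷ [])
        (v≁e ∷ v≁w ∷ v≁x ∷ v≁q ∷ z≁w ∷ z≁x ∷ sym≁ q≁z ∷ sym≁ p≁z ∷ e≁x ∷ sym≁ q≁e ∷ sym≁ p≁e
          ∷ sym≁ q≁w ∷ sym≁ p≁w ∷ x≁p ∷ [])
      where open Crossing c

    crossing-no-edge-seen-from-both-ends : ∀ {v z e w x p q} → Crossing v z e w x
      → p ∼ q → p ≁ z × p ≁ e × p ≁ w → q ≁ z × q ≁ e × q ≁ w
      → v ∼ p ⊎ v ∼ q → x ∼ p ⊎ x ∼ q → ⊥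
    crossing-no-edge-seen-from-both-ends {v} {z} {e} {w} {x} {p} {q} c p∼q p-misses q-misses = sees
      where
      common : ∀ {y} → y ≁ z × y ≁ e × y ≁ w → y ∼ v → y ∼ x → ⊥
      common (y≁z , y≁e , y≁w) y∼v y∼x = crossing-no-common-neighbour c y∼v y∼x y≁z y≁e y≁w

      linked : ∀ {s t} → s ∼ t → s ≁ z × s ≁ e × s ≁ w → t ≁ z × t ≁ e × t ≁ w
        → v ∼ s → x ∼ t → ⊥
      linked {s} {t} s∼t s-misses t-misses v∼s x∼t with adj? x s | adj? v t
      ... | yes x∼s | _ = common s-misses (sym v∼s) (sym x∼s)
      ... | no _ | yes v∼t = common t-misses (sym v∼t) (sym x∼t)
      ... | no x≁s | no v≁t = crossing-no-linking-edge c s∼t v∼s x∼t v≁t x≁s s-misses t-misses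

      sees : v ∼ p ⊎ v ∼ q → x ∼ p ⊎ x ∼ q → ⊥
      sees (inj₁ v∼p) (inj₁ x∼p) = common p-misses (sym v∼p) (sym x∼p)
      sees (inj₂ v∼q) (inj₂ x∼q) = common q-misses (sym v∼q) (sym x∼q)
      sees (inj₁ v∼p) (inj₂ x∼q) = linked p∼q p-misses q-misses v∼p x∼q
      sees (inj₂ v∼q) (inj₁ x∼p) = linked (sym p∼q) q-misses p-misses v∼q x∼p

  swap : Setting G → Setting G
  swap σ = record
    { S = S ; L = R ; R = L ; L-full = R-full ; R-full = L-full ; L≢R = λ R≡L → L≢R (≡-sym R≡L)
    ; Z = Z′ ; Z′ = Z ; Z⊆L = Z′⊆R ; Z′⊆R = Z⊆L ; Z-clique = Z′-clique ; Z′-clique = Z-clique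
    ; S⊆NZ = S⊆NZ′ ; S⊆NZ′ = S⊆NZ ; Z-priv = Z′-priv ; Z′-priv = Z-priv
    ; f = f ; g = g ; f-Z = f-Z′ ; g-Z = g-Z′ ; f-Z′ = f-Z ; g-Z′ = g-Z
    ; a₁ = d₁ ; a₂ = d₂ ; d₁ = a₁ ; d₂ = a₂
    ; a₁∈Z = d₁∈Z′ ; a₂∈Z = d₂∈Z′ ; a₁≢a₂ = d₁≢d₂ ; d₁∈Z′ = a₁∈Z ; d₂∈Z′ = a₂∈Z ; d₁≢d₂ = a₁≢a₂
    }
    where open Setting σ

  module SettingFacts (cC : InClassC G) (σ : Setting G) where
    open Setting σ
    open Construction σ using (b₁; r₁; ZL)
    open Forbidden cC

    L∩S=∅ : ∀ {v} → v ∈ L → v ∉ S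
    L∩S=∅ = proj₁ (proj₂ (proj₁ L-full)) _

    L-closed : ∀ {u v} → u ∈ L → u ∼ v → v ∉ S → v ∈ L
    L-closed = proj₂ (proj₂ (proj₂ (proj₁ L-full))) _ _

    L∩R=∅ : ∀ {v} → v ∈ L → v ∉ R
    L∩R=∅ v∈L v∈R = L≢R (⊆-antisym
      (components-overlap⇒⊆ (proj₁ L-full) (proj₁ R-full) v∈L v∈R)
      (components-overlap⇒⊆ (proj₁ R-full) (proj₁ L-full) v∈R v∈L))

    L≁R : ∀ {u w} → u ∈ L → w ∈ R → u ≁ w
    L≁R u∈L w∈R u∼w = L∩R=∅ (L-closed u∈L u∼w (proj₁ (proj₂ (proj₁ R-full)) _ w∈R)) w∈R

    outside-misses-L : ∀ {v u} → v ∉ L → v ∉ S → u ∈ L → v ≁ u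
    outside-misses-L v∉L v∉S u∈L v∼u = v∉L (L-closed u∈L (sym v∼u) v∉S)

    f∈S : ∀ {z} → z ∈ Z → f z ∈ S
    f∈S z∈Z = proj₁ (f-Z _ z∈Z)

    g∈R : ∀ {z} → z ∈ Z → g z ∈ R
    g∈R z∈Z = proj₁ (g-Z _ z∈Z)

    Z-private : ∀ {z₀ z} → z₀ ∈ Z → z ∈ Z → z ≢ z₀ → z ≁ f z₀
    Z-private z₀∈Z z∈Z z≢z₀ z∼f = proj₂ (proj₂ (f-Z _ z₀∈Z))
      ((λ (f∈Z , _) → L∩S=∅ (Z⊆L f∈Z) (f∈S z₀∈Z)) , _ , (z∈Z , z≢z₀) , z∼f)

    meets-triple : ∀ {v a} → v ∈ S → a ∈ Z → v ∼ a ⊎ v ∼ f a ⊎ v ∼ g a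
    meets-triple {v} {a} v∈S a∈Z with adj? v a | adj? v (f a) | adj? v (g a)
    ... | yes v∼a | _ | _ = inj₁ v∼a
    ... | no _ | yes v∼b | _ = inj₂ (inj₁ v∼b)
    ... | no _ | no _ | yes v∼r = inj₂ (inj₂ v∼r)
    ... | no v≁a | no v≁b | no v≁r
      with S⊆NZ v v∈S | S⊆NZ′ v v∈S | S⊆NZ′ (f a) (f∈S a∈Z)
    ... | _ , z , z∈Z , z∼v | _ , p , p∈Z′ , p∼v | _ , q , q∈Z′ , q∼b = ⊥-elim
      (no-bridged-P₅ (sym z∼v) (Z-clique z a z∈Z a∈Z z≢a) (proj₁ (proj₂ (f-Z a a∈Z)))
        (proj₂ (g-Z a a∈Z)) v≁a v≁b v≁r (Z-private a∈Z z∈Z z≢a)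
        (L≁R (Z⊆L z∈Z) (g∈R a∈Z)) (L≁R (Z⊆L a∈Z) (g∈R a∈Z))
        p∼v q∼b (Z′-clique p q p∈Z′ q∈Z′)
        (sym≁ (L≁R (Z⊆L z∈Z) (Z′⊆R p∈Z′))) (sym≁ (L≁R (Z⊆L a∈Z) (Z′⊆R p∈Z′)))
        (sym≁ (L≁R (Z⊆L z∈Z) (Z′⊆R q∈Z′))) (sym≁ (L≁R (Z⊆L a∈Z) (Z′⊆R q∈Z′))))
      where
      z≢a : z ≢ a
      z≢a = ∼≁⇒≢ z∼v (sym≁ v≁a)

    ZL-neighbour : ∀ {v} → v ∈ S → v ≁ a₁ → v ≁ a₂ → ∃ λ z → ZL z × z ∈ L × v ∼ z
    ZL-neighbour {v} v∈S v≁a₁ v≁a₂ with S⊆NZ v v∈S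
    ... | _ , z , z∈Z , z∼v =
      z , (Z-clique z a₁ z∈Z a₁∈Z z≢a₁ , Z-clique z a₂ z∈Z a₂∈Z z≢a₂ ,
           Z-private a₁∈Z z∈Z z≢a₁ , Z-private a₂∈Z z∈Z z≢a₂ ,
           L≁R (Z⊆L z∈Z) (g∈R a₁∈Z) , L≁R (Z⊆L z∈Z) (g∈R a₂∈Z)) ,
      Z⊆L z∈Z , sym z∼v
      where
      z≢a₁ = ∼≁⇒≢ z∼v (sym≁ v≁a₁)
      z≢a₂ = ∼≁⇒≢ z∼v (sym≁ v≁a₂)

    -- The crossing is v–z–a₂–w–x, and the edge b₁r₁ is seen from both of its ends.
    ZL-nested : ∀ {v x z w} → v ≁ x → v ∉ L → v ∉ S → x ∉ L → x ∉ S
      → v ∼ b₁ ⊎ v ∼ r₁ → x ∼ b₁ ⊎ x ∼ r₁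
      → ZL z → ZL w → v ∼ z → x ≁ z → x ∼ w → v ≁ w → ⊥
    ZL-nested {v} {x} {z} {w} v≁x v∉L v∉S x∉L x∉S v-sees x-sees
      (_ , z∼a₂ , z≁b₁ , _ , z≁r₁ , _) (_ , w∼a₂ , w≁b₁ , _ , w≁r₁ , _) v∼z x≁z x∼w v≁w =
      crossing-no-edge-seen-from-both-ends crossing (proj₂ (g-Z a₁ a₁∈Z))
        (sym≁ z≁b₁ , sym≁ (Z-private a₁∈Z a₂∈Z (≢-sym a₁≢a₂)) , sym≁ w≁b₁)
        (sym≁ z≁r₁ , sym≁ (L≁R a₂∈L (g∈R a₁∈Z)) , sym≁ w≁r₁)
        v-sees x-sees
      where
      a₂∈L = Z⊆L a₂∈Z
      crossing : Crossing v z a₂ w x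
      crossing = record
        { v∼z = v∼z ; z∼e = z∼a₂ ; e∼w = sym w∼a₂ ; w∼x = sym x∼w
        ; v≁e = outside-misses-L v∉L v∉S a₂∈L ; v≁w = v≁w ; v≁x = v≁x
        ; z≁x = sym≁ x≁z ; e≁x = sym≁ (outside-misses-L x∉L x∉S a₂∈L) }

  module FContainer (cC : InClassC G) (σ : Setting G) {k : ℕ} (F : Colouring G k)
    (iL iR : Fin k → Maybe (Fin n))
    (hL : ∀ j → Construction.IsIL σ F j (iL j)) (hR : ∀ j → Construction.IsIR σ F j (iR j))
    where
    open Setting σ
    open Construction σ
    open Colouring F
    open SettingFacts cC σ
    module Mirror = SettingFacts cC (swap σ)

    SeesR SeesL : Fin n → Set
    SeesR v = v ∼ r₁ ⊎ v ∼ r₂ ⊎ v ∼ d₁ ⊎ v ∼ d₂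
    SeesL v = v ∼ a₁ ⊎ v ∼ a₂ ⊎ v ∼ l₁ ⊎ v ∼ l₂

    ¬SeesR⇒LAmb : ∀ {v} → ¬ SeesR v → LAmb v
    ¬SeesR⇒LAmb ¬s _ (inj₁ e) _ = inj₁ e
    ¬SeesR⇒LAmb ¬s _ (inj₂ (inj₁ e)) _ = inj₂ (inj₁ e)
    ¬SeesR⇒LAmb ¬s _ (inj₂ (inj₂ (inj₁ e))) _ = inj₂ (inj₂ (inj₁ e))
    ¬SeesR⇒LAmb ¬s _ (inj₂ (inj₂ (inj₂ (inj₁ e)))) _ = inj₂ (inj₂ (inj₂ (inj₁ e)))
    ¬SeesR⇒LAmb ¬s _ (inj₂ (inj₂ (inj₂ (inj₂ (inj₁ refl))))) v∼ = ⊥-elim (¬s (inj₁ v∼))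
    ¬SeesR⇒LAmb ¬s _ (inj₂ (inj₂ (inj₂ (inj₂ (inj₂ (inj₁ refl)))))) v∼ = ⊥-elim (¬s (inj₂ (inj₁ v∼)))
    ¬SeesR⇒LAmb ¬s _ (inj₂ (inj₂ (inj₂ (inj₂ (inj₂ (inj₂ (inj₁ e))))))) _ = inj₂ (inj₂ (inj₂ (inj₂ (inj₁ e))))
    ¬SeesR⇒LAmb ¬s _ (inj₂ (inj₂ (inj₂ (inj₂ (inj₂ (inj₂ (inj₂ (inj₁ e)))))))) _ = inj₂ (inj₂ (inj₂ (inj₂ (inj₂ (inj₁ e)))))
    ¬SeesR⇒LAmb ¬s _ (inj₂ (inj₂ (inj₂ (inj₂ (inj₂ (inj₂ (inj₂ (inj₂ (inj₁ refl))))))))) v∼ = ⊥-elim (¬s (inj₂ (inj₂ (inj₁ v∼))))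
    ¬SeesR⇒LAmb ¬s _ (inj₂ (inj₂ (inj₂ (inj₂ (inj₂ (inj₂ (inj₂ (inj₂ (inj₂ (inj₁ refl)))))))))) v∼ = ⊥-elim (¬s (inj₂ (inj₂ (inj₂ v∼))))
    ¬SeesR⇒LAmb ¬s _ (inj₂ (inj₂ (inj₂ (inj₂ (inj₂ (inj₂ (inj₂ (inj₂ (inj₂ (inj₂ (inj₁ e))))))))))) _ = inj₂ (inj₂ (inj₂ (inj₂ (inj₂ (inj₂ (inj₁ e))))))
    ¬SeesR⇒LAmb ¬s _ (inj₂ (inj₂ (inj₂ (inj₂ (inj₂ (inj₂ (inj₂ (inj₂ (inj₂ (inj₂ (inj₂ e))))))))))) _ = inj₂ (inj₂ (inj₂ (inj₂ (inj₂ (inj₂ (inj₂ e))))))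

    ¬SeesL⇒RAmb : ∀ {v} → ¬ SeesL v → RAmb v
    ¬SeesL⇒RAmb ¬s _ (inj₁ refl) v∼ = ⊥-elim (¬s (inj₁ v∼))
    ¬SeesL⇒RAmb ¬s _ (inj₂ (inj₁ refl)) v∼ = ⊥-elim (¬s (inj₂ (inj₁ v∼)))
    ¬SeesL⇒RAmb ¬s _ (inj₂ (inj₂ (inj₁ e))) _ = inj₁ e
    ¬SeesL⇒RAmb ¬s _ (inj₂ (inj₂ (inj₂ (inj₁ e)))) _ = inj₂ (inj₁ e)
    ¬SeesL⇒RAmb ¬s _ (inj₂ (inj₂ (inj₂ (inj₂ (inj₁ e))))) _ = inj₂ (inj₂ (inj₂ (inj₂ (inj₂ (inj₂ (inj₁ e))))))
    ¬SeesL⇒RAmb ¬s _ (inj₂ (inj₂ (inj₂ (inj₂ (inj₂ (inj₁ e)))))) _ = inj₂ (inj₂ (inj₂ (inj₂ (inj₂ (inj₂ (inj₂ e))))))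
    ¬SeesL⇒RAmb ¬s _ (inj₂ (inj₂ (inj₂ (inj₂ (inj₂ (inj₂ (inj₁ e))))))) _ = inj₂ (inj₂ (inj₁ e))
    ¬SeesL⇒RAmb ¬s _ (inj₂ (inj₂ (inj₂ (inj₂ (inj₂ (inj₂ (inj₂ (inj₁ e)))))))) _ = inj₂ (inj₂ (inj₂ (inj₁ e)))
    ¬SeesL⇒RAmb ¬s _ (inj₂ (inj₂ (inj₂ (inj₂ (inj₂ (inj₂ (inj₂ (inj₂ (inj₁ e))))))))) _ = inj₂ (inj₂ (inj₂ (inj₂ (inj₁ e))))
    ¬SeesL⇒RAmb ¬s _ (inj₂ (inj₂ (inj₂ (inj₂ (inj₂ (inj₂ (inj₂ (inj₂ (inj₂ (inj₁ e)))))))))) _ = inj₂ (inj₂ (inj₂ (inj₂ (inj₂ (inj₁ e)))))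
    ¬SeesL⇒RAmb ¬s _ (inj₂ (inj₂ (inj₂ (inj₂ (inj₂ (inj₂ (inj₂ (inj₂ (inj₂ (inj₂ (inj₁ refl))))))))))) v∼ = ⊥-elim (¬s (inj₂ (inj₂ (inj₁ v∼))))
    ¬SeesL⇒RAmb ¬s _ (inj₂ (inj₂ (inj₂ (inj₂ (inj₂ (inj₂ (inj₂ (inj₂ (inj₂ (inj₂ (inj₂ refl))))))))))) v∼ = ⊥-elim (¬s (inj₂ (inj₂ (inj₂ v∼))))

    LAmb-target∉R : ∀ {w} → w ≡ a₁ ⊎ w ≡ a₂ ⊎ w ≡ b₁ ⊎ w ≡ b₂ ⊎ w ≡ c₁ ⊎ w ≡ c₂ ⊎ w ≡ l₁ ⊎ w ≡ l₂
      → w ∉ R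
    LAmb-target∉R (inj₁ refl) = L∩R=∅ (Z⊆L a₁∈Z)
    LAmb-target∉R (inj₂ (inj₁ refl)) = L∩R=∅ (Z⊆L a₂∈Z)
    LAmb-target∉R (inj₂ (inj₂ (inj₁ refl))) b₁∈R = Mirror.L∩S=∅ b₁∈R (f∈S a₁∈Z)
    LAmb-target∉R (inj₂ (inj₂ (inj₂ (inj₁ refl)))) b₂∈R = Mirror.L∩S=∅ b₂∈R (f∈S a₂∈Z)
    LAmb-target∉R (inj₂ (inj₂ (inj₂ (inj₂ (inj₁ refl))))) c₁∈R = Mirror.L∩S=∅ c₁∈R (Mirror.f∈S d₁∈Z′)
    LAmb-target∉R (inj₂ (inj₂ (inj₂ (inj₂ (inj₂ (inj₁ refl)))))) c₂∈R = Mirror.L∩S=∅ c₂∈R (Mirror.f∈S d₂∈Z′)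
    LAmb-target∉R (inj₂ (inj₂ (inj₂ (inj₂ (inj₂ (inj₂ (inj₁ refl))))))) = L∩R=∅ (Mirror.g∈R d₁∈Z′)
    LAmb-target∉R (inj₂ (inj₂ (inj₂ (inj₂ (inj₂ (inj₂ (inj₂ refl))))))) = L∩R=∅ (Mirror.g∈R d₂∈Z′)

    RAmb-target∉L : ∀ {w} → w ≡ b₁ ⊎ w ≡ b₂ ⊎ w ≡ c₁ ⊎ w ≡ c₂ ⊎ w ≡ d₁ ⊎ w ≡ d₂ ⊎ w ≡ r₁ ⊎ w ≡ r₂
      → w ∉ L
    RAmb-target∉L (inj₁ refl) b₁∈L = L∩S=∅ b₁∈L (f∈S a₁∈Z)
    RAmb-target∉L (inj₂ (inj₁ refl)) b₂∈L = L∩S=∅ b₂∈L (f∈S a₂∈Z)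
    RAmb-target∉L (inj₂ (inj₂ (inj₁ refl))) c₁∈L = L∩S=∅ c₁∈L (Mirror.f∈S d₁∈Z′)
    RAmb-target∉L (inj₂ (inj₂ (inj₂ (inj₁ refl)))) c₂∈L = L∩S=∅ c₂∈L (Mirror.f∈S d₂∈Z′)
    RAmb-target∉L (inj₂ (inj₂ (inj₂ (inj₂ (inj₁ refl))))) = Mirror.L∩R=∅ (Z′⊆R d₁∈Z′)
    RAmb-target∉L (inj₂ (inj₂ (inj₂ (inj₂ (inj₂ (inj₁ refl)))))) = Mirror.L∩R=∅ (Z′⊆R d₂∈Z′)
    RAmb-target∉L (inj₂ (inj₂ (inj₂ (inj₂ (inj₂ (inj₂ (inj₁ refl))))))) = Mirror.L∩R=∅ (g∈R a₁∈Z)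
    RAmb-target∉L (inj₂ (inj₂ (inj₂ (inj₂ (inj₂ (inj₂ (inj₂ refl))))))) = Mirror.L∩R=∅ (g∈R a₂∈Z)

    LAmb⇒¬SeesR : ∀ {v} → LAmb v → ¬ SeesR v
    LAmb⇒¬SeesR lamb (inj₁ v∼r₁) =
      LAmb-target∉R (lamb _ (inj₂ (inj₂ (inj₂ (inj₂ (inj₁ refl))))) v∼r₁) (g∈R a₁∈Z)
    LAmb⇒¬SeesR lamb (inj₂ (inj₁ v∼r₂)) =
      LAmb-target∉R (lamb _ (inj₂ (inj₂ (inj₂ (inj₂ (inj₂ (inj₁ refl)))))) v∼r₂) (g∈R a₂∈Z)
    LAmb⇒¬SeesR lamb (inj₂ (inj₂ (inj₁ v∼d₁))) =
      LAmb-target∉R (lamb _ (inj₂ (inj₂ (inj₂ (inj₂ (inj₂ (inj₂ (inj₂ (inj₂ (inj₁ refl))))))))) v∼d₁) (Z′⊆R d₁∈Z′)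
    LAmb⇒¬SeesR lamb (inj₂ (inj₂ (inj₂ v∼d₂))) =
      LAmb-target∉R (lamb _ (inj₂ (inj₂ (inj₂ (inj₂ (inj₂ (inj₂ (inj₂ (inj₂ (inj₂ (inj₁ refl)))))))))) v∼d₂) (Z′⊆R d₂∈Z′)

    RAmb⇒¬SeesL : ∀ {v} → RAmb v → ¬ SeesL v
    RAmb⇒¬SeesL ramb (inj₁ v∼a₁) = RAmb-target∉L (ramb _ (inj₁ refl) v∼a₁) (Z⊆L a₁∈Z)
    RAmb⇒¬SeesL ramb (inj₂ (inj₁ v∼a₂)) = RAmb-target∉L (ramb _ (inj₂ (inj₁ refl)) v∼a₂) (Z⊆L a₂∈Z)
    RAmb⇒¬SeesL ramb (inj₂ (inj₂ (inj₁ v∼l₁))) =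
      RAmb-target∉L (ramb _ (inj₂ (inj₂ (inj₂ (inj₂ (inj₂ (inj₂ (inj₂ (inj₂ (inj₂ (inj₂ (inj₁ refl))))))))))) v∼l₁)
        (Mirror.g∈R d₁∈Z′)
    RAmb⇒¬SeesL ramb (inj₂ (inj₂ (inj₂ v∼l₂))) =
      RAmb-target∉L (ramb _ (inj₂ (inj₂ (inj₂ (inj₂ (inj₂ (inj₂ (inj₂ (inj₂ (inj₂ (inj₂ (inj₂ refl))))))))))) v∼l₂)
        (Mirror.g∈R d₂∈Z′)

    SeesR-or-LAmb : ∀ v → SeesR v ⊎ LAmb v
    SeesR-or-LAmb v with adj? v r₁ ⊎-dec adj? v r₂ ⊎-dec adj? v d₁ ⊎-dec adj? v d₂
    ... | yes sees = inj₁ sees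
    ... | no ¬sees = inj₂ (¬SeesR⇒LAmb ¬sees)

    SeesL-or-RAmb : ∀ v → SeesL v ⊎ RAmb v
    SeesL-or-RAmb v with adj? v a₁ ⊎-dec adj? v a₂ ⊎-dec adj? v l₁ ⊎-dec adj? v l₂
    ... | yes sees = inj₁ sees
    ... | no ¬sees = inj₂ (¬SeesL⇒RAmb ¬sees)

    ¬LAmb⇒∈R : ∀ {v} → ¬ LAmb v → v ∉ S → v ∈ R
    ¬LAmb⇒∈R {v} ¬lamb v∉S with SeesR-or-LAmb v
    ... | inj₁ (inj₁ v∼r₁) = Mirror.L-closed (g∈R a₁∈Z) (sym v∼r₁) v∉S
    ... | inj₁ (inj₂ (inj₁ v∼r₂)) = Mirror.L-closed (g∈R a₂∈Z) (sym v∼r₂) v∉S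
    ... | inj₁ (inj₂ (inj₂ (inj₁ v∼d₁))) = Mirror.L-closed (Z′⊆R d₁∈Z′) (sym v∼d₁) v∉S
    ... | inj₁ (inj₂ (inj₂ (inj₂ v∼d₂))) = Mirror.L-closed (Z′⊆R d₂∈Z′) (sym v∼d₂) v∉S
    ... | inj₂ lamb = ⊥-elim (¬lamb lamb)

    ¬RAmb⇒∈L : ∀ {v} → ¬ RAmb v → v ∉ S → v ∈ L
    ¬RAmb⇒∈L {v} ¬ramb v∉S with SeesL-or-RAmb v
    ... | inj₁ (inj₁ v∼a₁) = L-closed (Z⊆L a₁∈Z) (sym v∼a₁) v∉S
    ... | inj₁ (inj₂ (inj₁ v∼a₂)) = L-closed (Z⊆L a₂∈Z) (sym v∼a₂) v∉S
    ... | inj₁ (inj₂ (inj₂ (inj₁ v∼l₁))) = L-closed (Mirror.g∈R d₁∈Z′) (sym v∼l₁) v∉S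
    ... | inj₁ (inj₂ (inj₂ (inj₂ v∼l₂))) = L-closed (Mirror.g∈R d₂∈Z′) (sym v∼l₂) v∉S
    ... | inj₂ ramb = ⊥-elim (¬ramb ramb)

    S-profile : ∀ {v} → v ∈ S → Profile v
    S-profile v∈S = meets-triple v∈S a₁∈Z , meets-triple v∈S a₂∈Z ,
      swap₁₂ (Mirror.meets-triple v∈S d₁∈Z′) , swap₁₂ (Mirror.meets-triple v∈S d₂∈Z′)
      where
      swap₁₂ : ∀ {A B C : Set} → A ⊎ B ⊎ C → B ⊎ A ⊎ C
      swap₁₂ (inj₁ a) = inj₂ (inj₁ a)
      swap₁₂ (inj₂ (inj₁ b)) = inj₁ b
      swap₁₂ (inj₂ (inj₂ c)) = inj₂ (inj₂ c)

    CandL⇒sees-c₁-or-l₁ : ∀ {j v} → CandL F j v → v ∼ c₁ ⊎ v ∼ l₁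
    CandL⇒sees-c₁-or-l₁ (_ , _ , _ , (_ , _ , inj₁ v∼c₁ , _) , _) = inj₁ v∼c₁
    CandL⇒sees-c₁-or-l₁ (_ , v∉S , v∉R , (_ , _ , inj₂ (inj₁ v∼d₁) , _) , _) =
      ⊥-elim (Mirror.outside-misses-L v∉R v∉S (Z′⊆R d₁∈Z′) v∼d₁)
    CandL⇒sees-c₁-or-l₁ (_ , _ , _ , (_ , _ , inj₂ (inj₂ v∼l₁) , _) , _) = inj₂ v∼l₁

    CandR⇒sees-b₁-or-r₁ : ∀ {j v} → CandR F j v → v ∼ b₁ ⊎ v ∼ r₁
    CandR⇒sees-b₁-or-r₁ (_ , v∉S , v∉L , (inj₁ v∼a₁ , _) , _) =
      ⊥-elim (outside-misses-L v∉L v∉S (Z⊆L a₁∈Z) v∼a₁)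
    CandR⇒sees-b₁-or-r₁ (_ , _ , _ , (inj₂ sees , _) , _) = sees

    CandL-laminar : ∀ j → Laminar Adj ZR (CandL F j)
    CandL-laminar j cu@(u∈I , u∉S , u∉R , _) cv@(v∈I , v∉S , v∉R , _) =
      Mirror.ZL-nested (indep j _ _ u∈I v∈I) u∉R u∉S v∉R v∉S
        (CandL⇒sees-c₁-or-l₁ cu) (CandL⇒sees-c₁-or-l₁ cv)

    CandR-laminar : ∀ j → Laminar Adj ZL (CandR F j)
    CandR-laminar j cu@(u∈I , u∉S , u∉L , _) cv@(v∈I , v∉S , v∉L , _) =
      ZL-nested (indep j _ _ u∈I v∈I) u∉L u∉S v∉L v∉S
        (CandR⇒sees-b₁-or-r₁ cu) (CandR⇒sees-b₁-or-r₁ cv)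

    iL-greatest : ∀ j {v z} → CandL F j v → ZR z → v ∼ z → AdjM (iL j) z
    iL-greatest j cv zZR v∼z with iL j | hL j
    ... | nothing | no-candidate = ⊥-elim (no-candidate _ cv)
    ... | just x | cx , maximal =
      laminar-maximal⇒greatest Adj ZR (CandL F j) adj? (CandL-laminar j) cx maximal cv zZR v∼z

    iR-greatest : ∀ j {v z} → CandR F j v → ZL z → v ∼ z → AdjM (iR j) z
    iR-greatest j cv zZL v∼z with iR j | hR j
    ... | nothing | no-candidate = ⊥-elim (no-candidate _ cv)
    ... | just x | cx , maximal =
      laminar-maximal⇒greatest Adj ZL (CandR F j) adj? (CandR-laminar j) cx maximal cv zZL v∼z

    iL-misses-R : ∀ j {z} → z ∈ R → ¬ AdjM (iL j) z
    iL-misses-R j z∈R with iL j | hL j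
    ... | nothing | _ = λ ()
    ... | just x | (_ , x∉S , x∉R , _) , _ = Mirror.outside-misses-L x∉R x∉S z∈R

    iR-misses-L : ∀ j {z} → z ∈ L → ¬ AdjM (iR j) z
    iR-misses-L j z∈L with iR j | hR j
    ... | nothing | _ = λ ()
    ... | just x | (_ , x∉S , x∉L , _) , _ = outside-misses-L x∉L x∉S z∈L

    CandL⇒¬HitZR : ∀ {j v} → CandL F j v → ¬ HitZR F iL iR v
    CandL⇒¬HitZR {j} cv (_ , zZR , v∼z , unseen) = unseen j (iL-greatest j cv zZR v∼z)

    CandR⇒¬HitZL : ∀ {j v} → CandR F j v → ¬ HitZL F iL iR v
    CandR⇒¬HitZL {j} cv (_ , zZL , v∼z , unseen) = unseen j (iR-greatest j cv zZL v∼z)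

    S-LAmb⇒HitZR : ∀ {v} → v ∈ S → LAmb v → HitZR F iL iR v
    S-LAmb⇒HitZR v∈S lamb
      with Mirror.ZL-neighbour v∈S (LAmb⇒¬SeesR lamb ∘ inj₂ ∘ inj₂ ∘ inj₁) (LAmb⇒¬SeesR lamb ∘ inj₂ ∘ inj₂ ∘ inj₂)
    ... | z , zZR , z∈R , v∼z = z , zZR , v∼z , λ j → iL-misses-R j z∈R

    S-RAmb⇒HitZL : ∀ {v} → v ∈ S → RAmb v → HitZL F iL iR v
    S-RAmb⇒HitZL v∈S ramb
      with ZL-neighbour v∈S (RAmb⇒¬SeesL ramb ∘ inj₁) (RAmb⇒¬SeesL ramb ∘ inj₂ ∘ inj₁)
    ... | z , zZL , z∈L , v∼z = z , zZL , v∼z , λ j → iR-misses-L j z∈L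

    S⊆Ŝ : ∀ v → v ∈ S → Ŝ F iL iR v
    S⊆Ŝ v v∈S with SeesR-or-LAmb v | SeesL-or-RAmb v
    ... | inj₁ sR | inj₁ sL =
      inj₂ (inj₁ (S-profile v∈S , (λ lamb → LAmb⇒¬SeesR lamb sR) , λ ramb → RAmb⇒¬SeesL ramb sL))
    ... | inj₂ lamb | inj₁ sL =
      inj₂ (inj₂ (inj₁ (S-profile v∈S , lamb , (λ ramb → RAmb⇒¬SeesL ramb sL) , S-LAmb⇒HitZR v∈S lamb)))
    ... | inj₁ sR | inj₂ ramb =
      inj₂ (inj₂ (inj₂ (inj₁ (S-profile v∈S , ramb , (λ lamb → LAmb⇒¬SeesR lamb sR) , S-RAmb⇒HitZL v∈S ramb))))
    ... | inj₂ lamb | inj₂ ramb =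
      inj₂ (inj₂ (inj₂ (inj₂ (S-profile v∈S , lamb , ramb , S-LAmb⇒HitZR v∈S lamb , S-RAmb⇒HitZL v∈S ramb))))

    F∖S-misses-Ŝ : ∀ {j v} → v ∈ I j → v ∉ S → ¬ Ŝ F iL iR v
    F∖S-misses-Ŝ _ v∉S (inj₁ (inj₁ refl)) = v∉S (f∈S a₁∈Z)
    F∖S-misses-Ŝ _ v∉S (inj₁ (inj₂ (inj₁ refl))) = v∉S (f∈S a₂∈Z)
    F∖S-misses-Ŝ _ v∉S (inj₁ (inj₂ (inj₂ (inj₁ refl)))) = v∉S (Mirror.f∈S d₁∈Z′)
    F∖S-misses-Ŝ _ v∉S (inj₁ (inj₂ (inj₂ (inj₂ refl)))) = v∉S (Mirror.f∈S d₂∈Z′)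
    F∖S-misses-Ŝ _ v∉S (inj₂ (inj₁ (_ , ¬lamb , ¬ramb))) = L∩R=∅ (¬RAmb⇒∈L ¬ramb v∉S) (¬LAmb⇒∈R ¬lamb v∉S)
    F∖S-misses-Ŝ v∈I v∉S (inj₂ (inj₂ (inj₁ (P , lamb , ¬ramb , hit)))) =
      CandL⇒¬HitZR (v∈I , v∉S , L∩R=∅ (¬RAmb⇒∈L ¬ramb v∉S) , P , lamb) hit
    F∖S-misses-Ŝ v∈I v∉S (inj₂ (inj₂ (inj₂ (inj₁ (P , ramb , ¬lamb , hit))))) =
      CandR⇒¬HitZL (v∈I , v∉S , (λ v∈L → L∩R=∅ v∈L (¬LAmb⇒∈R ¬lamb v∉S)) , P , ramb) hit
    F∖S-misses-Ŝ {v = v} v∈I v∉S (inj₂ (inj₂ (inj₂ (inj₂ (P , lamb , ramb , hitR , hitL))))) with v ∈? R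
    ... | yes v∈R = CandR⇒¬HitZL (v∈I , v∉S , (λ v∈L → L∩R=∅ v∈L v∈R) , P , ramb) hitL
    ... | no v∉R = CandL⇒¬HitZR (v∈I , v∉S , v∉R , P , lamb) hitR

    F∩Ŝ⊆S : ∀ {v} → VF v → Ŝ F iL iR v → v ∈ S
    F∩Ŝ⊆S {v} (j , v∈I) v∈Ŝ with v ∈? S
    ... | yes v∈S = v∈S
    ... | no v∉S = ⊥-elim (F∖S-misses-Ŝ v∈I v∉S v∈Ŝ)

lemma3p7 : {n : ℕ} (G : Graph n) → InClassC G → (σ : Setting G)
    → {k : ℕ} (F : Colouring G k) (iL iR : Fin k → Maybe (Fin n))
    → (∀ j → Construction.IsIL σ F j (iL j))
    → (∀ j → Construction.IsIR σ F j (iR j))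
    → Construction.IsFContainer σ F iL iR
lemma3p7 G cC σ F iL iR hL hR = S⊆Ŝ , λ v v∈F → F∩Ŝ⊆S v∈F , S⊆Ŝ v
  where open FContainer cC σ F iL iR hL hR
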